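{- On a star (with distinct, unweighted tokens), any sorting swap sequence that at some point swaps the token on a leaf while that leaf is happy has length at least $\mathrm{OPT}+2$, where $\mathrm{OPT}$ is the minimum length of a sorting swap sequence.
   Context: A star is a tree with one non-leaf vertex (the center). Tokens $1,\dots,n$ are placed one per vertex and each token has a destination vertex; a swap exchanges the tokens on the endpoints of an edge; a sorting swap sequence brings every token to its destination. A leaf is happy at a given moment if the token currently on it has that leaf as destination. -}

module Defs where

open import Data.Nat using (ℕ; zero; suc; _+_; _≤_)
open import Data.Fin using (Fin; zero; suc; _≟_)
open import Data.List using (List; []; _∷_; _++_; length)
open import Data.Product using (Σ; _×_; ∃; ∃-syntax; _,_)
open import Relation.Nullary using (yes; no)
open import Relation.Binary.PropositionalEquality using (_≡_)
open import Function.Definitions using (Injective)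

-- The star K_{1,m}: vertices are Fin (suc m); vertex zero is the center,
-- vertex (suc l) for l : Fin m is the l-th leaf. Edges are {zero, suc l},
-- so an edge (and a swap) is identified with a leaf l : Fin m.
Vertex : ℕ → Set
Vertex m = Fin (suc m)

Token : ℕ → Set
Token m = Fin (suc m)

Placement : ℕ → Set
Placement m = Vertex m → Token m

swap : ∀ {m} → Fin m → Placement m → Placement m
swap l p zero = p (suc l)
swap l p (suc v) with v ≟ l
... | yes _ = p zero
... | no  _ = p (suc v)

applySeq : ∀ {m} → List (Fin m) → Placement m → Placement m
applySeq []       p = p
applySeq (l ∷ ls) p = applySeq ls (swap l p)

Sorted : ∀ {m} → (Token m → Vertex m) → Placement m → Set
Sorted dest p = ∀ v → dest (p v) ≡ v

IsSortingSeq : ∀ {m} → (Token m → Vertex m) → Placement m → List (Fin m) → Set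
IsSortingSeq dest p ls = Sorted dest (applySeq ls p)

Happy : ∀ {m} → (Token m → Vertex m) → Placement m → Fin m → Set
Happy dest p l = dest (p (suc l)) ≡ suc l

SwapsHappyLeaf : ∀ {m} → (Token m → Vertex m) → Placement m → List (Fin m) → Set
SwapsHappyLeaf dest p ls =
  ∃[ pre ] ∃[ l ] ∃[ post ] (ls ≡ pre ++ (l ∷ post)) × Happy dest (applySeq pre p) l

IsOPT : ∀ {m} → (Token m → Vertex m) → Placement m → ℕ → Set
IsOPT dest p k =
  (∃[ ls ] IsSortingSeq dest p ls × length ls ≡ k)
  × (∀ ls → IsSortingSeq dest p ls → k ≤ length ls)

-- Since swap l P is P composed with the transposition τ l of the center
-- and leaf l, all bookkeeping is permutation algebra on vertices.  The core is the exchange lemma: if W is N with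
-- the tokens on a happy leaf l and another vertex x exchanged, every
-- sequence sorting W yields a strictly shorter one sorting N.  Applied
-- right after the happy swap (x = center), it shortens the sequence by
-- two, and optimality of OPT gives the theorem.
module Submission where

open import Defs
open import Data.Fin using (Fin; zero; suc)
open import Data.List using (List; []; _∷_; _++_; length)
open import Data.List.Properties using (length-++)
open import Data.Nat using (ℕ; suc; _+_; _≤_; _<_; s≤s)
open import Data.Nat.Properties using (n<1+n; ≤-trans; +-assoc; +-comm; +-monoʳ-≤; +-monoˡ-≤; module ≤-Reasoning)
open import Data.Product using (∃-syntax; _×_; _,_)
open import Data.Empty using (⊥-elim)
open import Data.Fin.Properties using (_≟_; suc-injective)
open import Data.Fin.Permutation.Components using (transpose)
open import Function.Definitions using (Injective)
open import Function.Base using (_∘_)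
open import Relation.Nullary using (yes; no)
open import Relation.Nullary.Decidable using (dec-true; dec-false)
open import Relation.Binary.PropositionalEquality
  using (_≡_; _≢_; _≗_; refl; sym; trans; cong; cong₂; subst; module ≡-Reasoning)

transpose-i : ∀ {n} (i j : Fin n) → transpose i j i ≡ j
transpose-i i j rewrite dec-true (i ≟ i) refl = refl

transpose-j : ∀ {n} (i j : Fin n) → transpose i j j ≡ i
transpose-j i j with j ≟ i
... | yes j≡i = j≡i
... | no _ rewrite dec-true (j ≟ j) refl = refl

transpose-other : ∀ {n} {i j k : Fin n} → k ≢ i → k ≢ j → transpose i j k ≡ k
transpose-other {i = i} {j} {k} k≢i k≢j
  rewrite dec-false (k ≟ i) k≢i | dec-false (k ≟ j) k≢j = refl

data Position {n} (i j : Fin n) : Fin n → Set where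
  at-i  : Position i j i
  at-j  : Position i j j
  apart : ∀ {k} → k ≢ i → k ≢ j → Position i j k

position : ∀ {n} (i j k : Fin n) → Position i j k
position i j k with k ≟ i | k ≟ j
... | yes refl | _        = at-i
... | no _     | yes refl = at-j
... | no k≢i   | no k≢j   = apart k≢i k≢j

transpose-involutive : ∀ {n} (i j k : Fin n) → transpose i j (transpose i j k) ≡ k
transpose-involutive i j k with position i j k
... | at-i = trans (cong (transpose i j) (transpose-i i j)) (transpose-j i j)
... | at-j = trans (cong (transpose i j) (transpose-j i j)) (transpose-i i j)
... | apart k≢i k≢j =
  trans (cong (transpose i j) (transpose-other k≢i k≢j)) (transpose-other k≢i k≢j)

transpose-injective : ∀ {n} (i j : Fin n) → Injective _≡_ _≡_ (transpose i j)
transpose-injective i j {k} {k'} eq = begin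
  k                                    ≡⟨ sym (transpose-involutive i j k) ⟩
  transpose i j (transpose i j k)      ≡⟨ cong (transpose i j) eq ⟩
  transpose i j (transpose i j k')     ≡⟨ transpose-involutive i j k' ⟩
  k'                                   ∎
  where open ≡-Reasoning

transpose-natural : ∀ {n n'} (π : Fin n → Fin n') → Injective _≡_ _≡_ π → (i j k : Fin n)
  → π (transpose i j k) ≡ transpose (π i) (π j) (π k)
transpose-natural π π-inj i j k with position i j k
... | at-i = trans (cong π (transpose-i i j)) (sym (transpose-i (π i) (π j)))
... | at-j = trans (cong π (transpose-j i j)) (sym (transpose-j (π i) (π j)))
... | apart k≢i k≢j = trans (cong π (transpose-other k≢i k≢j))
                            (sym (transpose-other (k≢i ∘ π-inj) (k≢j ∘ π-inj)))

τ : ∀ {m} → Fin m → Vertex m → Vertex m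
τ a = transpose zero (suc a)

τ-involutive : ∀ {m} (a : Fin m) (v : Vertex m) → τ a (τ a v) ≡ v
τ-involutive a = transpose-involutive zero (suc a)

τ-fixes-leaf : ∀ {m} {a b : Fin m} → b ≢ a → τ a (suc b) ≡ suc b
τ-fixes-leaf b≢a = transpose-other {i = zero} (λ ()) (b≢a ∘ suc-injective)

swap-is-τ : ∀ {m} (a : Fin m) (P : Placement m) → swap a P ≗ P ∘ τ a
swap-is-τ a P zero = refl
swap-is-τ a P (suc v) with v ≟ a
... | yes refl = refl
... | no _     = refl

swap-cong : ∀ {m} (a : Fin m) {P Q : Placement m} → P ≗ Q → swap a P ≗ swap a Q
swap-cong a {P} {Q} P≈Q v = trans (swap-is-τ a P v) (trans (P≈Q (τ a v)) (sym (swap-is-τ a Q v)))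

applySeq-cong : ∀ {m} (s : List (Fin m)) {P Q : Placement m} → P ≗ Q → applySeq s P ≗ applySeq s Q
applySeq-cong []      P≈Q = P≈Q
applySeq-cong (a ∷ s) P≈Q = applySeq-cong s (swap-cong a P≈Q)

sorted-resp : ∀ {m} (dest : Token m → Vertex m) {P Q : Placement m} → P ≗ Q → Sorted dest P → Sorted dest Q
sorted-resp dest P≈Q P-sorted v = trans (cong dest (sym (P≈Q v))) (P-sorted v)

applySeq-++ : ∀ {m} (xs ys : List (Fin m)) (P : Placement m) → applySeq (xs ++ ys) P ≡ applySeq ys (applySeq xs P)
applySeq-++ []       ys P = refl
applySeq-++ (x ∷ xs) ys P = applySeq-++ xs ys (swap x P)

swap-injective : ∀ {m} (a : Fin m) {P : Placement m} → Injective _≡_ _≡_ P → Injective _≡_ _≡_ (swap a P)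
swap-injective a {P} P-inj {v} {w} eq =
  transpose-injective zero (suc a) (P-inj (trans (sym (swap-is-τ a P v)) (trans eq (swap-is-τ a P w))))

applySeq-injective : ∀ {m} (s : List (Fin m)) {P : Placement m} → Injective _≡_ _≡_ P → Injective _≡_ _≡_ (applySeq s P)
applySeq-injective []      P-inj = P-inj
applySeq-injective (a ∷ s) P-inj = applySeq-injective s (swap-injective a P-inj)

happy-swap : ∀ {m} (dest : Token m → Vertex m) {P : Placement m} {a l : Fin m}
  → a ≢ l → Happy dest P l → Happy dest (swap a P) l
happy-swap dest {P} {a} {l} a≢l happy =
  trans (cong dest (trans (swap-is-τ a P (suc l)) (cong P (τ-fixes-leaf (a≢l ∘ sym))))) happy

transpose-past-τ : ∀ {m} {a l : Fin m} (x : Vertex m) → a ≢ l → (v : Vertex m)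
  → transpose x (suc l) (τ a v) ≡ τ a (transpose (τ a x) (suc l) v)
transpose-past-τ {a = a} {l} x a≢l v = sym (begin
  τ a (transpose (τ a x) (suc l) v)
    ≡⟨ transpose-natural (τ a) (transpose-injective zero (suc a)) (τ a x) (suc l) v ⟩
  transpose (τ a (τ a x)) (τ a (suc l)) (τ a v)
    ≡⟨ cong₂ (λ y z → transpose y z (τ a v)) (τ-involutive a x) (τ-fixes-leaf (a≢l ∘ sym)) ⟩
  transpose x (suc l) (τ a v) ∎)
  where open ≡-Reasoning

transpose-past-own-τ : ∀ {m} (u l : Fin m) (v : Vertex m)
  → transpose (suc u) (suc l) (τ l v) ≡ τ u (transpose (suc u) (suc l) v)
transpose-past-own-τ u l v = begin
  transpose (suc u) (suc l) (τ l v)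
    ≡⟨ transpose-natural (transpose (suc u) (suc l)) (transpose-injective (suc u) (suc l)) zero (suc l) v ⟩
  transpose (transpose (suc u) (suc l) zero) (transpose (suc u) (suc l) (suc l)) (transpose (suc u) (suc l) v)
    ≡⟨ cong₂ (λ y z → transpose y z (transpose (suc u) (suc l) v))
             (transpose-other {i = suc u} {j = suc l} (λ ()) (λ ())) (transpose-j (suc u) (suc l)) ⟩
  τ u (transpose (suc u) (suc l) v) ∎
  where open ≡-Reasoning

-- Induction on the sequence, carrying the exchanged pair along: a swap
-- on another leaf a is kept and moves x to τ a x; a swap on l either
-- undoes the exchange (x the center: drop it) or, for x a leaf u, is
-- replaced by a swap on u.  If the sequence ends first, W sorted would
-- force N x and N l to have the same destination l, so x = l.
exchange : ∀ {m} (dest : Token m → Vertex m) → Injective _≡_ _≡_ dest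
  → (l : Fin m) (N : Placement m) → Injective _≡_ _≡_ N → Happy dest N l
  → (x : Vertex m) → x ≢ suc l
  → (W : Placement m) → W ≗ N ∘ transpose x (suc l)
  → (s : List (Fin m)) → IsSortingSeq dest W s
  → ∃[ s' ] IsSortingSeq dest N s' × length s' < length s
exchange dest dest-inj l N N-inj happy x x≢l W W≈ [] W-sorted =
  ⊥-elim (x≢l (N-inj (dest-inj same-destination)))
  where
  open ≡-Reasoning
  same-destination : dest (N x) ≡ dest (N (suc l))
  same-destination = begin
    dest (N x)                                 ≡⟨ cong (dest ∘ N) (sym (transpose-j x (suc l))) ⟩
    dest (N (transpose x (suc l) (suc l)))     ≡⟨ cong dest (sym (W≈ (suc l))) ⟩
    dest (W (suc l))                           ≡⟨ W-sorted (suc l) ⟩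
    suc l                                      ≡⟨ sym happy ⟩
    dest (N (suc l))                           ∎
exchange dest dest-inj l N N-inj happy x x≢l W W≈ (a ∷ s) W-sorted with a ≟ l
... | no a≢l
  with exchange dest dest-inj l (swap a N) (swap-injective a N-inj) (happy-swap dest a≢l happy)
                (τ a x) τax≢l (swap a W) swapped s W-sorted
  where
  τax≢l : τ a x ≢ suc l
  τax≢l eq = x≢l (transpose-injective zero (suc a) (trans eq (sym (τ-fixes-leaf (a≢l ∘ sym)))))
  swapped : swap a W ≗ swap a N ∘ transpose (τ a x) (suc l)
  swapped v = trans (swap-is-τ a W v) (trans (W≈ (τ a v))
                (trans (cong N (transpose-past-τ x a≢l v)) (sym (swap-is-τ a N (transpose (τ a x) (suc l) v)))))
...   | s' , N'-sorted , shorter = a ∷ s' , N'-sorted , s≤s shorter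
exchange dest dest-inj l N N-inj happy zero x≢l W W≈ (l ∷ s) W-sorted | yes refl =
  s , sorted-resp dest (applySeq-cong s undone) W-sorted , n<1+n (length s)
  where
  undone : swap l W ≗ N
  undone v = trans (swap-is-τ l W v) (trans (W≈ (τ l v)) (cong N (τ-involutive l v)))
exchange dest dest-inj l N N-inj happy (suc u) x≢l W W≈ (l ∷ s) W-sorted | yes refl
  with exchange dest dest-inj l (swap u N) (swap-injective u N-inj) (happy-swap dest u≢l happy)
                (suc u) x≢l (swap l W) replaced s W-sorted
  where
  u≢l : u ≢ l
  u≢l = x≢l ∘ cong suc
  replaced : swap l W ≗ swap u N ∘ transpose (suc u) (suc l)
  replaced v = trans (swap-is-τ l W v) (trans (W≈ (τ l v))
                 (trans (cong N (transpose-past-own-τ u l v)) (sym (swap-is-τ u N (transpose (suc u) (suc l) v)))))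
... | s' , N'-sorted , shorter = u ∷ s' , N'-sorted , s≤s shorter

-- A sorting sequence that swaps a happy leaf can be shortened by two:
-- the swap itself is wasted, and by the exchange lemma the remainder,
-- which sorts the placement with the happy token moved to the center,
-- can be replaced by a strictly shorter sequence sorting the placement
-- before the swap.
shorten-happy-swap : ∀ {m} (dest : Token m → Vertex m) → Injective _≡_ _≡_ dest
  → (p : Placement m) → Injective _≡_ _≡_ p
  → (ls : List (Fin m)) → IsSortingSeq dest p ls → SwapsHappyLeaf dest p ls
  → ∃[ ls' ] IsSortingSeq dest p ls' × length ls' + 2 ≤ length ls
shorten-happy-swap dest dest-inj p p-inj _ sorts (pre , l , post , refl , happy)
  with exchange dest dest-inj l (applySeq pre p) (applySeq-injective pre p-inj) happy
                zero (λ ()) (swap l (applySeq pre p)) (swap-is-τ l (applySeq pre p))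
                post (subst (Sorted dest) (applySeq-++ pre (l ∷ post) p) sorts)
... | s' , s'-sorts , shorter =
  pre ++ s' , subst (Sorted dest) (sym (applySeq-++ pre s' p)) s'-sorts , two-shorter
  where
  open ≤-Reasoning
  two-shorter : length (pre ++ s') + 2 ≤ length (pre ++ l ∷ post)
  two-shorter = begin
    length (pre ++ s') + 2            ≡⟨ cong (_+ 2) (length-++ pre) ⟩
    length pre + length s' + 2        ≡⟨ +-assoc (length pre) (length s') 2 ⟩
    length pre + (length s' + 2)      ≡⟨ cong (length pre +_) (+-comm (length s') 2) ⟩
    length pre + suc (suc (length s')) ≤⟨ +-monoʳ-≤ (length pre) (s≤s shorter) ⟩
    length pre + suc (length post)    ≡⟨ length-++ pre ⟨
    length (pre ++ l ∷ post)          ∎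

lemma6p4 : (m : ℕ) → 2 ≤ m
    → (p : Placement m) → Injective _≡_ _≡_ p
    → (dest : Token m → Vertex m) → Injective _≡_ _≡_ dest
    → (ls : List (Fin m)) → IsSortingSeq dest p ls → SwapsHappyLeaf dest p ls
    → (opt : ℕ) → IsOPT dest p opt
    → opt + 2 ≤ length ls
lemma6p4 m _ p p-inj dest dest-inj ls sorts happy-swap opt (_ , optimal)
  with shorten-happy-swap dest dest-inj p p-inj ls sorts happy-swap
... | ls' , ls'-sorts , two-shorter = ≤-trans (+-monoˡ-≤ 2 (optimal ls' ls'-sorts)) two-shorter
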